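{- If $\Gamma$ is a strongly regular graph with parameters $(3250,57,0,1)$, then the line graph of $\Gamma$ is not a Cayley graph.
   Context: A strongly regular graph with parameters $(v,k,\lambda,\mu)$ is a $k$-regular graph on $v$ vertices in which adjacent vertices have $\lambda$ common neighbours and non-adjacent vertices have $\mu$ common neighbours. A graph is a Cayley graph if it is isomorphic to $\mathrm{Cay}(G,S)$ for some finite group $G$ with identity $e$ and inverse-closed $S\subseteq G\setminus\{e\}$, where $a\sim b$ iff $ab^{ -1}\in S$. -}

module Defs where

open import Data.Nat using (ℕ; zero; suc; _+_)
open import Data.Fin using (Fin; zero; suc; _<_)
open import Data.Bool using (Bool; true; false; if_then_else_)
open import Data.Product using (Σ; _×_; _,_; proj₁; proj₂; ∃-syntax)
open import Data.Sum using (_⊎_)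
open import Relation.Nullary using (¬_)
open import Relation.Binary.PropositionalEquality using (_≡_; _≢_)
open import Algebra.Structures using (IsGroup)
open import Function.Bundles using (_↔_; _⇔_; Inverse)
open import Level using (0ℓ)

count : (n : ℕ) → (Fin n → Bool) → ℕ
count zero    p = 0
count (suc n) p = (if p zero then 1 else 0) + count n (λ i → p (suc i))

_∧ᵇ_ : Bool → Bool → Bool
true  ∧ᵇ b = b
false ∧ᵇ b = false

record SimpleGraph (v : ℕ) : Set where
  field
    adj   : Fin v → Fin v → Bool
    sym   : ∀ i j → adj i j ≡ adj j i
    irrefl : ∀ i → adj i i ≡ false

module _ {v : ℕ} (Γ : SimpleGraph v) where
  open SimpleGraph Γ

  degree : Fin v → ℕ
  degree i = count v (λ j → adj i j)

  commonNeighbours : Fin v → Fin v → ℕ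
  commonNeighbours i j = count v (λ w → adj i w ∧ᵇ adj j w)

  IsSRG : ℕ → ℕ → ℕ → Set
  IsSRG k l m =
      (∀ i → degree i ≡ k)
    × (∀ i j → i ≢ j → adj i j ≡ true  → commonNeighbours i j ≡ l)
    × (∀ i j → i ≢ j → adj i j ≡ false → commonNeighbours i j ≡ m)

  Edge : Set
  Edge = Σ (Fin v × Fin v) λ p → (proj₁ p < proj₂ p) × (adj (proj₁ p) (proj₂ p) ≡ true)

  LineAdj : Edge → Edge → Set
  LineAdj ((a , b) , _) ((c , d) , _) =
    ((a , b) ≢ (c , d)) × (a ≡ c ⊎ a ≡ d ⊎ b ≡ c ⊎ b ≡ d)

-- A graph given by a vertex type V and adjacency relation _~_ is a Cayley
-- graph if it is isomorphic to Cay(G,S) for a finite group G (WLOG with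
-- underlying set Fin n) and inverse-closed S ⊆ G ∖ {e}, where in Cay(G,S)
-- a ~ b iff a b⁻¹ ∈ S.
IsCayley : (V : Set) → (V → V → Set) → Set₁
IsCayley V _~_ =
  Σ ℕ λ n →
  Σ (Fin n → Fin n → Fin n) λ _∙_ →
  Σ (Fin n) λ e →
  Σ (Fin n → Fin n) λ inv →
    IsGroup {A = Fin n} _≡_ _∙_ e inv
  × Σ (Fin n → Set) (λ S →
        (∀ x → S x → S (inv x))
      × ¬ S e
      × Σ (V ↔ Fin n) (λ φ →
          ∀ a b → (a ~ b) ⇔ S (Inverse.to φ a ∙ inv (Inverse.to φ b))))

-- Suppose L(Γ) ≅ Cay(G,S).  Right translations of G are then automorphisms of
-- L(Γ) acting regularly on the edges of Γ.  Since Γ is triangle-free and every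
-- vertex has degree ≥ 2, each automorphism of L(Γ) is induced by a unique map
-- on vertices (a Whitney-type argument), so G acts on Γ edge-regularly.
-- Transporting the two ends of one fixed edge along this action orients every
-- edge of Γ, and the orientation is G-invariant.  Two cases:
--  * some vertex is both a tail and a head: then G is vertex-transitive, so all
--    out-degrees agree and all in-degrees agree; double counting arcs shows that
--    they are equal, hence the valency 57 would be even;
--  * no vertex is both: then "being a tail" 2-colours Γ, but an SRG(v,k,0,1)
--    contains a closed walk of length five.
module Submission where

open import Defs
open import Data.Nat using (ℕ; zero; suc; _+_; _*_; _≤_; z≤n; s≤s; NonZero)
import Data.Nat.Properties as ℕₚ
open import Data.Fin using (Fin; zero; suc; _<_)
import Data.Fin.Properties as Finₚ
open import Data.Fin.Permutation using (permutation)
open import Data.Bool using (Bool; true; false; if_then_else_)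
import Data.Bool.Properties as Boolₚ
open import Data.Product using (Σ; _×_; _,_; proj₁; proj₂; ∃-syntax)
open import Data.Sum using (_⊎_; inj₁; inj₂)
open import Data.Empty using (⊥; ⊥-elim)
open import Function using (_∘_)
open import Function.Bundles using (_↔_; _⇔_; Inverse; Equivalence; mk⇔)
open import Relation.Nullary using (¬_; Dec; yes; no; does)
open import Relation.Nullary.Decidable using (dec-true; dec-false; does-⇔)
open import Relation.Binary.PropositionalEquality
open import Relation.Binary.Definitions using (tri<; tri≈; tri>)
open import Axiom.UniquenessOfIdentityProofs using (module Decidable⇒UIP)
open import Algebra.Structures using (IsGroup)
open import Algebra.Bundles using (Group)
open import Level using (0ℓ)
import Algebra.Properties.CommutativeMonoid.Sum ℕₚ.+-0-commutativeMonoid as Σℕ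
open Σℕ using (sum; sum-syntax)

𝟙 : Bool → ℕ
𝟙 b = if b then 1 else 0

-- Rewriting `count` as a finite sum gives access to the library's lemmas on
-- reindexing, linearity and interchange of sums.
count≡sum : ∀ n (p : Fin n → Bool) → count n p ≡ sum (λ i → 𝟙 (p i))
count≡sum zero    p = refl
count≡sum (suc n) p = cong (𝟙 (p zero) +_) (count≡sum n (λ i → p (suc i)))

count-cong : ∀ n {p q : Fin n → Bool} → (∀ i → p i ≡ q i) → count n p ≡ count n q
count-cong zero    p≗q = refl
count-cong (suc n) p≗q = cong₂ _+_ (cong 𝟙 (p≗q zero)) (count-cong n (λ i → p≗q (suc i)))

count-permute : ∀ n (p : Fin n → Bool) (π π⁻¹ : Fin n → Fin n) →
                (∀ i → π (π⁻¹ i) ≡ i) → (∀ i → π⁻¹ (π i) ≡ i) →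
                count n (λ i → p (π i)) ≡ count n p
count-permute n p π π⁻¹ right left = begin
  count n (λ i → p (π i))  ≡⟨ count≡sum n _ ⟩
  sum (λ i → 𝟙 (p (π i)))  ≡⟨ Σℕ.sum-permute (λ i → 𝟙 (p i)) (permutation π π⁻¹ right left) ⟨
  sum (λ i → 𝟙 (p i))      ≡⟨ count≡sum n p ⟨
  count n p                ∎
  where open ≡-Reasoning

count-split : ∀ n (r p q : Fin n → Bool) → (∀ i → 𝟙 (r i) ≡ 𝟙 (p i) + 𝟙 (q i)) →
              count n r ≡ count n p + count n q
count-split n r p q r≡p⊔q = begin
  count n r                                ≡⟨ count≡sum n r ⟩
  sum (λ i → 𝟙 (r i))                      ≡⟨ Σℕ.sum-cong-≗ r≡p⊔q ⟩
  sum (λ i → 𝟙 (p i) + 𝟙 (q i))            ≡⟨ Σℕ.∑-distrib-+ (λ i → 𝟙 (p i)) (λ i → 𝟙 (q i)) ⟩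
  sum (λ i → 𝟙 (p i)) + sum (λ i → 𝟙 (q i)) ≡⟨ cong₂ _+_ (count≡sum n p) (count≡sum n q) ⟨
  count n p + count n q                    ∎
  where open ≡-Reasoning

sum-const : ∀ n c → sum {n} (λ _ → c) ≡ n * c
sum-const zero    c = refl
sum-const (suc n) c = cong (c +_) (sum-const n c)

balanced : ∀ n .{{_ : NonZero n}} (o : Fin n → Fin n → Bool) {D I : ℕ} →
           (∀ x → count n (o x) ≡ D) → (∀ y → count n (λ x → o x y) ≡ I) → D ≡ I
balanced n o {D} {I} outdeg≡D indeg≡I = ℕₚ.*-cancelˡ-≡ D I n (begin
  n * D                          ≡⟨ sum-const n D ⟨
  ∑[ x < n ] D                   ≡⟨ Σℕ.sum-cong-≗ (λ x → trans (sym (outdeg≡D x)) (count≡sum n (o x))) ⟩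
  ∑[ x < n ] ∑[ y < n ] 𝟙 (o x y) ≡⟨ Σℕ.∑-comm (λ x y → 𝟙 (o x y)) ⟩
  ∑[ y < n ] ∑[ x < n ] 𝟙 (o x y) ≡⟨ Σℕ.sum-cong-≗ (λ y → trans (sym (count≡sum n _)) (indeg≡I y)) ⟩
  ∑[ y < n ] I                   ≡⟨ sum-const n I ⟩
  n * I                          ∎)
  where open ≡-Reasoning

count-≥1 : ∀ n (p : Fin n → Bool) {i} → p i ≡ true → 1 ≤ count n p
count-≥1 (suc n) p {zero}  pᵢ rewrite pᵢ = s≤s z≤n
count-≥1 (suc n) p {suc i} pᵢ with p zero
... | true  = s≤s z≤n
... | false = count-≥1 n (λ j → p (suc j)) pᵢ

count-≥2 : ∀ n (p : Fin n → Bool) {i j} → i ≢ j → p i ≡ true → p j ≡ true → 2 ≤ count n p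
count-≥2 (suc n) p {zero}  {zero}  i≢j pᵢ pⱼ = ⊥-elim (i≢j refl)
count-≥2 (suc n) p {zero}  {suc j} i≢j pᵢ pⱼ rewrite pᵢ = s≤s (count-≥1 n (λ k → p (suc k)) pⱼ)
count-≥2 (suc n) p {suc i} {zero}  i≢j pᵢ pⱼ rewrite pⱼ = s≤s (count-≥1 n (λ k → p (suc k)) pᵢ)
count-≥2 (suc n) p {suc i} {suc j} i≢j pᵢ pⱼ =
  ℕₚ.≤-trans (count-≥2 n (λ k → p (suc k)) (i≢j ∘ cong suc) pᵢ pⱼ) (ℕₚ.m≤n+m _ (𝟙 (p zero)))

count≡0⇒none : ∀ n (p : Fin n → Bool) → count n p ≡ 0 → ∀ {i} → p i ≡ true → ⊥
count≡0⇒none n p count≡0 pᵢ with () ← subst (1 ≤_) count≡0 (count-≥1 n p pᵢ)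

count≡1⇒unique : ∀ n (p : Fin n → Bool) → count n p ≡ 1 →
                 ∀ {i j} → p i ≡ true → p j ≡ true → i ≡ j
count≡1⇒unique n p count≡1 {i} {j} pᵢ pⱼ with i Finₚ.≟ j
... | yes i≡j = i≡j
... | no  i≢j with s≤s () ← subst (2 ≤_) count≡1 (count-≥2 n p i≢j pᵢ pⱼ)

count-witness : ∀ n (p : Fin n → Bool) → 1 ≤ count n p → ∃[ i ] p i ≡ true
count-witness (suc n) p h with p zero in p₀
... | true  = zero , p₀
... | false with count-witness n (λ i → p (suc i)) h
...   | i , pᵢ = suc i , pᵢ

count-two-witnesses : ∀ n (p : Fin n → Bool) → 2 ≤ count n p →
                      Σ (Fin n) λ i → Σ (Fin n) λ j → i ≢ j × p i ≡ true × p j ≡ true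
count-two-witnesses (suc n) p h with p zero in p₀
... | true with count-witness n (λ i → p (suc i)) (ℕₚ.≤-pred h)
...   | j , pⱼ = zero , suc j , (λ ()) , p₀ , pⱼ
count-two-witnesses (suc n) p h | false with count-two-witnesses n (λ i → p (suc i)) h
...   | i , j , i≢j , pᵢ , pⱼ = suc i , suc j , i≢j ∘ Finₚ.suc-injective , pᵢ , pⱼ

TriangleFree : ∀ {v} → SimpleGraph v → Set
TriangleFree {v} Γ = ∀ {a b c : Fin v} → adj a b ≡ true → adj a c ≡ true → adj b c ≡ true → ⊥
  where open SimpleGraph Γ

module Edges {v : ℕ} (Γ : SimpleGraph v) where
  open SimpleGraph Γ renaming (sym to adj-sym)

  E : Set
  E = Edge Γ

  lo hi : E → Fin v
  lo ((a , _) , _) = a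
  hi ((_ , b) , _) = b

  _∈ₑ_ : Fin v → E → Set
  x ∈ₑ e = x ≡ lo e ⊎ x ≡ hi e

  lo≢hi : (e : E) → lo e ≢ hi e
  lo≢hi (_ , lo<hi , _) lo≡hi = Finₚ.<-irrefl lo≡hi lo<hi

  adj⇒≢ : ∀ {a b} → adj a b ≡ true → a ≢ b
  adj⇒≢ {a} ab refl with () ← trans (sym ab) (irrefl a)

  -- The proofs of `lo < hi` and of adjacency carried by an edge are irrelevant.
  edge-ext : (e e' : E) → lo e ≡ lo e' → hi e ≡ hi e' → e ≡ e'
  edge-ext ((a , b) , lt , ab) ((.a , .b) , lt' , ab') refl refl
    rewrite Finₚ.<-irrelevant lt lt' | Decidable⇒UIP.≡-irrelevant Boolₚ._≟_ ab ab' = refl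

  _≟ₑ_ : (e e' : E) → Dec (e ≡ e')
  e ≟ₑ e' with lo e Finₚ.≟ lo e' | hi e Finₚ.≟ hi e'
  ... | yes lo≡ | yes hi≡ = yes (edge-ext e e' lo≡ hi≡)
  ... | no  lo≢ | _       = no (lo≢ ∘ cong lo)
  ... | yes _   | no  hi≢ = no (hi≢ ∘ cong hi)

  edge-through : ∀ {x y} → adj x y ≡ true → Σ E λ e → x ∈ₑ e × y ∈ₑ e
  edge-through {x} {y} xy with Finₚ.<-cmp x y
  ... | tri< x<y _ _ = ((x , y) , x<y , xy) , inj₁ refl , inj₂ refl
  ... | tri≈ _ x≡y _ = ⊥-elim (adj⇒≢ xy x≡y)
  ... | tri> _ _ y<x = ((y , x) , y<x , trans (adj-sym y x) xy) , inj₂ refl , inj₁ refl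

  ends-adjacent : ∀ {a b} (e : E) → a ∈ₑ e → b ∈ₑ e → a ≢ b → adj a b ≡ true
  ends-adjacent e (inj₁ refl) (inj₁ refl) a≢b = ⊥-elim (a≢b refl)
  ends-adjacent e (inj₂ refl) (inj₂ refl) a≢b = ⊥-elim (a≢b refl)
  ends-adjacent e (inj₁ refl) (inj₂ refl) _   = proj₂ (proj₂ e)
  ends-adjacent e (inj₂ refl) (inj₁ refl) _   = trans (adj-sym _ _) (proj₂ (proj₂ e))

  other-end : ∀ {a b c} (e : E) → a ∈ₑ e → b ∈ₑ e → c ∈ₑ e → a ≢ b → a ≢ c → b ≡ c
  other-end e (inj₁ refl) (inj₁ refl) _           a≢b _   = ⊥-elim (a≢b refl)
  other-end e (inj₂ refl) (inj₂ refl) _           a≢b _   = ⊥-elim (a≢b refl)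
  other-end e (inj₁ refl) (inj₂ refl) (inj₁ refl) _   a≢c = ⊥-elim (a≢c refl)
  other-end e (inj₂ refl) (inj₁ refl) (inj₂ refl) _   a≢c = ⊥-elim (a≢c refl)
  other-end e (inj₁ refl) (inj₂ refl) (inj₂ refl) _   _   = refl
  other-end e (inj₂ refl) (inj₁ refl) (inj₁ refl) _   _   = refl

  edge-unique : ∀ {z z'} (e e' : E) → z ≢ z' → z ∈ₑ e → z' ∈ₑ e → z ∈ₑ e' → z' ∈ₑ e' → e ≡ e'
  edge-unique e e' z≢z' (inj₁ refl) (inj₁ refl) _ _ = ⊥-elim (z≢z' refl)
  edge-unique e e' z≢z' (inj₂ refl) (inj₂ refl) _ _ = ⊥-elim (z≢z' refl)
  edge-unique e e' z≢z' _ _ (inj₁ z≡) (inj₁ z'≡) = ⊥-elim (z≢z' (trans z≡ (sym z'≡)))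
  edge-unique e e' z≢z' _ _ (inj₂ z≡) (inj₂ z'≡) = ⊥-elim (z≢z' (trans z≡ (sym z'≡)))
  edge-unique e e' _ (inj₁ refl) (inj₂ refl) (inj₁ lo≡) (inj₂ hi≡) = edge-ext e e' lo≡ hi≡
  edge-unique e e' _ (inj₂ refl) (inj₁ refl) (inj₂ hi≡) (inj₁ lo≡) = edge-ext e e' lo≡ hi≡
  edge-unique e e' _ (inj₁ refl) (inj₂ refl) (inj₂ lo≡hi') (inj₁ hi≡lo') =
    ⊥-elim (Finₚ.<-asym (proj₁ (proj₂ e)) (subst₂ _<_ (sym hi≡lo') (sym lo≡hi') (proj₁ (proj₂ e'))))
  edge-unique e e' _ (inj₂ refl) (inj₁ refl) (inj₁ hi≡lo') (inj₂ lo≡hi') =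
    ⊥-elim (Finₚ.<-asym (proj₁ (proj₂ e)) (subst₂ _<_ (sym hi≡lo') (sym lo≡hi') (proj₁ (proj₂ e'))))

  meet⇒LineAdj : ∀ {z} {e e' : E} → e ≢ e' → z ∈ₑ e → z ∈ₑ e' → LineAdj Γ e e'
  meet⇒LineAdj {e = e} {e'} e≢e' z∈e z∈e' =
    (λ ends≡ → e≢e' (edge-ext e e' (cong proj₁ ends≡) (cong proj₂ ends≡))) , shared z∈e z∈e'
    where
    shared : ∀ {z} → z ∈ₑ e → z ∈ₑ e' →
             lo e ≡ lo e' ⊎ lo e ≡ hi e' ⊎ hi e ≡ lo e' ⊎ hi e ≡ hi e'
    shared (inj₁ refl) (inj₁ refl) = inj₁ refl
    shared (inj₁ refl) (inj₂ refl) = inj₂ (inj₁ refl)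
    shared (inj₂ refl) (inj₁ refl) = inj₂ (inj₂ (inj₁ refl))
    shared (inj₂ refl) (inj₂ refl) = inj₂ (inj₂ (inj₂ refl))

  LineAdj⇒meet : (e e' : E) → LineAdj Γ e e' → Σ (Fin v) λ z → z ∈ₑ e × z ∈ₑ e'
  LineAdj⇒meet e e' (_ , inj₁ lo≡lo)               = lo e , inj₁ refl , inj₁ lo≡lo
  LineAdj⇒meet e e' (_ , inj₂ (inj₁ lo≡hi))        = lo e , inj₁ refl , inj₂ lo≡hi
  LineAdj⇒meet e e' (_ , inj₂ (inj₂ (inj₁ hi≡lo))) = hi e , inj₂ refl , inj₁ hi≡lo
  LineAdj⇒meet e e' (_ , inj₂ (inj₂ (inj₂ hi≡hi))) = hi e , inj₂ refl , inj₂ hi≡hi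

  -- In a triangle-free graph, if distinct edges f₁, f₂ meet in z and an edge f
  -- meets both of them, then f passes through z: otherwise z and the two meeting
  -- points would form a triangle.
  meets-both⇒through : TriangleFree Γ → ∀ {z p q} (f f₁ f₂ : E) → f₁ ≢ f₂ →
                       z ∈ₑ f₁ → z ∈ₑ f₂ → p ∈ₑ f → p ∈ₑ f₁ → q ∈ₑ f → q ∈ₑ f₂ → z ∈ₑ f
  meets-both⇒through no△ {z} {p} {q} f f₁ f₂ f₁≢f₂ z∈f₁ z∈f₂ p∈f p∈f₁ q∈f q∈f₂
    with p Finₚ.≟ z | q Finₚ.≟ z
  ... | yes refl | _        = p∈f
  ... | no _     | yes refl = q∈f
  ... | no p≢z   | no q≢z with p Finₚ.≟ q
  ...   | yes refl = ⊥-elim (f₁≢f₂ (edge-unique f₁ f₂ p≢z p∈f₁ z∈f₁ q∈f₂ z∈f₂))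
  ...   | no p≢q   = ⊥-elim (no△ (ends-adjacent f₁ z∈f₁ p∈f₁ (p≢z ∘ sym))
                                 (ends-adjacent f₂ z∈f₂ q∈f₂ (q≢z ∘ sym))
                                 (ends-adjacent f p∈f q∈f p≢q))

  record TwoEdgesAt (x : Fin v) : Set where
    field
      e₁ e₂    : E
      distinct : e₁ ≢ e₂
      x∈e₁     : x ∈ₑ e₁
      x∈e₂     : x ∈ₑ e₂

module InducedVertexMap {v : ℕ} (Γ : SimpleGraph v) (no△ : TriangleFree Γ)
  (star : ∀ x → Edges.TwoEdgesAt Γ x)
  (α : Edge Γ → Edge Γ) (α-inj : ∀ {e e'} → α e ≡ α e' → e ≡ e')
  (α-adj : ∀ {e e'} → LineAdj Γ e e' → LineAdj Γ (α e) (α e')) where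
  open Edges Γ

  images-meet : ∀ {x} {e e' : E} → e ≢ e' → x ∈ₑ e → x ∈ₑ e' →
                Σ (Fin v) λ z → z ∈ₑ α e × z ∈ₑ α e'
  images-meet {e = e} {e'} e≢e' x∈e x∈e' = LineAdj⇒meet (α e) (α e') (α-adj (meet⇒LineAdj e≢e' x∈e x∈e'))

  σ : Fin v → Fin v
  σ x = proj₁ (images-meet distinct x∈e₁ x∈e₂)
    where open TwoEdgesAt (star x)

  σ∈ : ∀ {x e} → x ∈ₑ e → σ x ∈ₑ α e
  σ∈ {x} {e} x∈e = through (e ≟ₑ e₁) (e ≟ₑ e₂)
    where
    open TwoEdgesAt (star x)
    σx∈αe₁ : σ x ∈ₑ α e₁
    σx∈αe₁ = proj₁ (proj₂ (images-meet distinct x∈e₁ x∈e₂))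
    σx∈αe₂ : σ x ∈ₑ α e₂
    σx∈αe₂ = proj₂ (proj₂ (images-meet distinct x∈e₁ x∈e₂))
    through : Dec (e ≡ e₁) → Dec (e ≡ e₂) → σ x ∈ₑ α e
    through (yes e≡e₁) _          = subst (λ f → σ x ∈ₑ α f) (sym e≡e₁) σx∈αe₁
    through (no _)     (yes e≡e₂) = subst (λ f → σ x ∈ₑ α f) (sym e≡e₂) σx∈αe₂
    through (no e≢e₁)  (no e≢e₂)  =
      let p , p∈αe , p∈αe₁ = images-meet e≢e₁ x∈e x∈e₁
          q , q∈αe , q∈αe₂ = images-meet e≢e₂ x∈e x∈e₂
      in meets-both⇒through no△ (α e) (α e₁) (α e₂) (distinct ∘ α-inj)
                            σx∈αe₁ σx∈αe₂ p∈αe p∈αe₁ q∈αe q∈αe₂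

  σ-unique : ∀ {x z} {e e' : E} → e ≢ e' → x ∈ₑ e → x ∈ₑ e' → z ∈ₑ α e → z ∈ₑ α e' → z ≡ σ x
  σ-unique {x} {z} {e} {e'} e≢e' x∈e x∈e' z∈αe z∈αe' with z Finₚ.≟ σ x
  ... | yes z≡σx = z≡σx
  ... | no  z≢σx = ⊥-elim (e≢e' (α-inj (edge-unique (α e) (α e') z≢σx z∈αe (σ∈ x∈e) z∈αe' (σ∈ x∈e'))))

module _ {v : ℕ} (Γ : SimpleGraph v) where
  open SimpleGraph Γ

  record Pentagon : Set where
    field
      p₀ p₁ p₂ p₃ p₄ : Fin v
      p₀p₁ : adj p₀ p₁ ≡ true
      p₁p₂ : adj p₁ p₂ ≡ true
      p₂p₃ : adj p₂ p₃ ≡ true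
      p₃p₄ : adj p₃ p₄ ≡ true
      p₄p₀ : adj p₄ p₀ ≡ true

  -- A graph 2-coloured by P (adjacent vertices never agree on P) has no closed
  -- walk of odd length five: going once around flips P five times.
  two-colouring⇒no-pentagon : (P : Fin v → Set) →
    (∀ {x y} → adj x y ≡ true → P x → ¬ P y) →
    (∀ {x y} → adj x y ≡ true → ¬ P x → P y) → ¬ Pentagon
  two-colouring⇒no-pentagon P P⇒¬P ¬P⇒P pentagon =
    ¬Pp₀ (¬P⇒P p₄p₀ (P⇒¬P p₃p₄ (¬P⇒P p₂p₃ (P⇒¬P p₁p₂ (¬P⇒P p₀p₁ ¬Pp₀)))))
    where
    open Pentagon pentagon
    ¬Pp₀ : ¬ P p₀
    ¬Pp₀ Pp₀ = P⇒¬P p₄p₀ (¬P⇒P p₃p₄ (P⇒¬P p₂p₃ (¬P⇒P p₁p₂ (P⇒¬P p₀p₁ Pp₀)))) Pp₀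

module SRG01 {v : ℕ} (Γ : SimpleGraph v) {k : ℕ} (srg : IsSRG Γ k 0 1) (2≤k : 2 ≤ k) where
  open SimpleGraph Γ renaming (sym to adj-sym)
  open Edges Γ

  private
    ∧ᵇ-intro : ∀ {a b} → a ≡ true → b ≡ true → (a ∧ᵇ b) ≡ true
    ∧ᵇ-intro refl refl = refl

    ∧ᵇ-elim : ∀ {a b} → (a ∧ᵇ b) ≡ true → a ≡ true × b ≡ true
    ∧ᵇ-elim {true} b≡true = refl , b≡true

  no△ : TriangleFree Γ
  no△ {a} {b} ab ac bc =
    count≡0⇒none v (λ w → adj a w ∧ᵇ adj b w) (proj₁ (proj₂ srg) a b (adj⇒≢ ab) ab) (∧ᵇ-intro ac bc)

  common-neighbour : ∀ {a b} → a ≢ b → adj a b ≡ false → ∃[ w ] adj a w ≡ true × adj b w ≡ true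
  common-neighbour {a} {b} a≢b ab with count-witness v (λ w → adj a w ∧ᵇ adj b w)
                                         (subst (1 ≤_) (sym (proj₂ (proj₂ srg) a b a≢b ab)) (s≤s z≤n))
  ... | w , aw∧bw = w , ∧ᵇ-elim aw∧bw

  common-neighbour-unique : ∀ {a b w w'} → a ≢ b → adj a b ≡ false →
    adj a w ≡ true → adj b w ≡ true → adj a w' ≡ true → adj b w' ≡ true → w ≡ w'
  common-neighbour-unique {a} {b} a≢b ab aw bw aw' bw' =
    count≡1⇒unique v (λ w → adj a w ∧ᵇ adj b w) (proj₂ (proj₂ srg) a b a≢b ab) (∧ᵇ-intro aw bw) (∧ᵇ-intro aw' bw')

  two-neighbours : ∀ x → Σ (Fin v) λ i → Σ (Fin v) λ j → i ≢ j × adj x i ≡ true × adj x j ≡ true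
  two-neighbours x = count-two-witnesses v (adj x) (subst (2 ≤_) (sym (proj₁ srg x)) 2≤k)

  neighbour-avoiding : ∀ x a → ∃[ d ] adj x d ≡ true × d ≢ a
  neighbour-avoiding x a with two-neighbours x
  ... | i , j , i≢j , xi , xj with i Finₚ.≟ a
  ...   | yes i≡a = j , xj , (λ j≡a → i≢j (trans i≡a (sym j≡a)))
  ...   | no  i≢a = i , xi , i≢a

  star : ∀ x → TwoEdgesAt x
  star x with two-neighbours x
  ... | i , j , i≢j , xi , xj with edge-through xi | edge-through xj
  ...   | e , x∈e , i∈e | f , x∈f , j∈f = record
    { e₁ = e ; e₂ = f ; x∈e₁ = x∈e ; x∈e₂ = x∈f
    ; distinct = λ { refl → i≢j (other-end e x∈e i∈e j∈f (adj⇒≢ xi) (adj⇒≢ xj)) } }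

  -- Γ contains a pentagon through any vertex a: take neighbours b ≢ c of a and
  -- a neighbour d ≢ a of b; then c, d are distinct and non-adjacent, so they have
  -- a common neighbour w, and a c w d b is a closed walk.
  pentagon : Fin v → Pentagon Γ
  pentagon a with two-neighbours a
  ... | b , c , b≢c , ab , ac with neighbour-avoiding b a
  ...   | d , bd , d≢a = record
    { p₀ = a ; p₁ = c ; p₂ = w ; p₃ = d ; p₄ = b
    ; p₀p₁ = ac ; p₁p₂ = cw ; p₂p₃ = trans (adj-sym w d) dw
    ; p₃p₄ = trans (adj-sym d b) bd ; p₄p₀ = trans (adj-sym b a) ab }
    where
    a≁d : adj a d ≡ false
    a≁d = Boolₚ.¬-not (no△ (trans (adj-sym b a) ab) bd)
    c≢d : c ≢ d
    c≢d refl = no△ ab ac bd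
    c≁d : adj c d ≡ false
    c≁d = Boolₚ.¬-not λ cd → b≢c (common-neighbour-unique (d≢a ∘ sym) a≁d
                                    ab (trans (adj-sym d b) bd) ac (trans (adj-sym d c) cd))
    w-spec : ∃[ w ] adj c w ≡ true × adj d w ≡ true
    w-spec = common-neighbour c≢d c≁d
    w : Fin v
    w = proj₁ w-spec
    cw : adj c w ≡ true
    cw = proj₁ (proj₂ w-spec)
    dw : adj d w ≡ true
    dw = proj₂ (proj₂ w-spec)

-- Suppose φ : Edge Γ ↔ G identifies L(Γ) with Cay(G,S).  Right multiplication
-- by g preserves a b⁻¹, hence gives automorphisms ρ g of L(Γ); they act
-- regularly on the edges.
module CayleyLineGraph {v : ℕ} (Γ : SimpleGraph v) (no△ : TriangleFree Γ)
  (star : ∀ x → Edges.TwoEdgesAt Γ x)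
  {n : ℕ} {_∙_ : Fin n → Fin n → Fin n} {ε : Fin n} {inv : Fin n → Fin n}
  (isGroup : IsGroup _≡_ _∙_ ε inv) {S : Fin n → Set} (φ : Edge Γ ↔ Fin n)
  (cayley : ∀ a b → LineAdj Γ a b ⇔ S (Inverse.to φ a ∙ inv (Inverse.to φ b))) where
  open SimpleGraph Γ renaming (sym to adj-sym)
  open Edges Γ
  open IsGroup isGroup using (assoc; identityˡ; identityʳ; inverseˡ; inverseʳ)
  open Inverse φ using (to; from; strictlyInverseˡ; strictlyInverseʳ)

  G : Group 0ℓ 0ℓ
  G = record { isGroup = isGroup }
  open import Algebra.Properties.Group G using (⁻¹-anti-homo-∙; ∙-cancelʳ)

  ρ : Fin n → E → E
  ρ g e = from (to e ∙ g)

  to-ρ : ∀ g e → to (ρ g e) ≡ to e ∙ g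
  to-ρ g e = strictlyInverseˡ (to e ∙ g)

  right-invariant : ∀ a b g → (a ∙ g) ∙ inv (b ∙ g) ≡ a ∙ inv b
  right-invariant a b g = begin
    (a ∙ g) ∙ inv (b ∙ g)     ≡⟨ cong ((a ∙ g) ∙_) (⁻¹-anti-homo-∙ b g) ⟩
    (a ∙ g) ∙ (inv g ∙ inv b) ≡⟨ assoc a g _ ⟩
    a ∙ (g ∙ (inv g ∙ inv b)) ≡⟨ cong (a ∙_) (assoc g (inv g) (inv b)) ⟨
    a ∙ ((g ∙ inv g) ∙ inv b) ≡⟨ cong (λ h → a ∙ (h ∙ inv b)) (inverseʳ g) ⟩
    a ∙ (ε ∙ inv b)           ≡⟨ cong (a ∙_) (identityˡ (inv b)) ⟩
    a ∙ inv b                 ∎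
    where open ≡-Reasoning

  ρ-adj : ∀ g {a b} → LineAdj Γ a b → LineAdj Γ (ρ g a) (ρ g b)
  ρ-adj g {a} {b} a~b = Equivalence.from (cayley (ρ g a) (ρ g b))
    (subst S (sym same-quotient) (Equivalence.to (cayley a b) a~b))
    where
    same-quotient : to (ρ g a) ∙ inv (to (ρ g b)) ≡ to a ∙ inv (to b)
    same-quotient = trans (cong₂ (λ x y → x ∙ inv y) (to-ρ g a) (to-ρ g b)) (right-invariant (to a) (to b) g)

  ρ-inj : ∀ g {a b} → ρ g a ≡ ρ g b → a ≡ b
  ρ-inj g {a} {b} ρa≡ρb = begin
    a             ≡⟨ strictlyInverseʳ a ⟨
    from (to a)   ≡⟨ cong from (∙-cancelʳ g (to a) (to b) translates-equal) ⟩
    from (to b)   ≡⟨ strictlyInverseʳ b ⟩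
    b             ∎
    where
    open ≡-Reasoning
    translates-equal : to a ∙ g ≡ to b ∙ g
    translates-equal = trans (sym (to-ρ g a)) (trans (cong to ρa≡ρb) (to-ρ g b))

  ρ-∘ : ∀ g h e → ρ h (ρ g e) ≡ ρ (g ∙ h) e
  ρ-∘ g h e = cong from (trans (cong (_∙ h) (to-ρ g e)) (assoc (to e) g h))

  ρ-ε : ∀ e → ρ ε e ≡ e
  ρ-ε e = trans (cong from (identityʳ (to e))) (strictlyInverseʳ e)

  ρ-carries : ∀ e e' → ρ (inv (to e) ∙ to e') e ≡ e'
  ρ-carries e e' = begin
    from (to e ∙ (inv (to e) ∙ to e')) ≡⟨ cong from (assoc (to e) (inv (to e)) (to e')) ⟨
    from ((to e ∙ inv (to e)) ∙ to e') ≡⟨ cong (λ h → from (h ∙ to e')) (inverseʳ (to e)) ⟩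
    from (ε ∙ to e')                   ≡⟨ cong from (identityˡ (to e')) ⟩
    from (to e')                       ≡⟨ strictlyInverseʳ e' ⟩
    e'                                 ∎
    where open ≡-Reasoning

  module Induced (g : Fin n) = InducedVertexMap Γ no△ star (ρ g) (ρ-inj g) (ρ-adj g)

  σ : Fin n → Fin v → Fin v
  σ g = Induced.σ g

  σ∈ : ∀ g {x e} → x ∈ₑ e → σ g x ∈ₑ ρ g e
  σ∈ g = Induced.σ∈ g

  σ-char : ∀ g x z → (∀ {e} → x ∈ₑ e → z ∈ₑ ρ g e) → z ≡ σ g x
  σ-char g x z on-image = Induced.σ-unique g distinct x∈e₁ x∈e₂ (on-image x∈e₁) (on-image x∈e₂)
    where open TwoEdgesAt (star x)

  σ-∘ : ∀ g h x → σ h (σ g x) ≡ σ (g ∙ h) x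
  σ-∘ g h x = σ-char (g ∙ h) x _ (λ {e} x∈e → subst (σ h (σ g x) ∈ₑ_) (ρ-∘ g h e) (σ∈ h (σ∈ g x∈e)))

  σ-ε : ∀ x → σ ε x ≡ x
  σ-ε x = sym (σ-char ε x x (λ {e} x∈e → subst (x ∈ₑ_) (sym (ρ-ε e)) x∈e))

  σ-inverseˡ : ∀ g x → σ (inv g) (σ g x) ≡ x
  σ-inverseˡ g x = trans (σ-∘ g (inv g) x) (trans (cong (λ h → σ h x) (inverseʳ g)) (σ-ε x))

  σ-inverseʳ : ∀ g x → σ g (σ (inv g) x) ≡ x
  σ-inverseʳ g x = trans (σ-∘ (inv g) g x) (trans (cong (λ h → σ h x) (inverseˡ g)) (σ-ε x))

  σ-inj : ∀ g {x y} → σ g x ≡ σ g y → x ≡ y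
  σ-inj g {x} {y} σx≡σy = trans (sym (σ-inverseˡ g x)) (trans (cong (σ (inv g)) σx≡σy) (σ-inverseˡ g y))

  -- The G-invariant orientation: fix the edge e₀ corresponding to ε and orient
  -- every edge e by transporting the ends of e₀ along the translation to e.
  e₀ : E
  e₀ = from ε

  tail head : E → Fin v
  tail e = σ (to e) (lo e₀)
  head e = σ (to e) (hi e₀)

  ρ-from-e₀ : ∀ e → ρ (to e) e₀ ≡ e
  ρ-from-e₀ e = trans (cong from (trans (cong (_∙ to e) (strictlyInverseˡ ε)) (identityˡ (to e))))
                      (strictlyInverseʳ e)

  tail∈ : ∀ e → tail e ∈ₑ e
  tail∈ e = subst (tail e ∈ₑ_) (ρ-from-e₀ e) (σ∈ (to e) (inj₁ refl))

  head∈ : ∀ e → head e ∈ₑ e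
  head∈ e = subst (head e ∈ₑ_) (ρ-from-e₀ e) (σ∈ (to e) (inj₂ refl))

  tail≢head : ∀ e → tail e ≢ head e
  tail≢head e = lo≢hi e₀ ∘ σ-inj (to e)

  tail-ρ : ∀ h e → tail (ρ h e) ≡ σ h (tail e)
  tail-ρ h e = trans (cong (λ g → σ g (lo e₀)) (to-ρ h e)) (sym (σ-∘ (to e) h (lo e₀)))

  head-ρ : ∀ h e → head (ρ h e) ≡ σ h (head e)
  head-ρ h e = trans (cong (λ g → σ g (hi e₀)) (to-ρ h e)) (sym (σ-∘ (to e) h (hi e₀)))

  tail-or-head : ∀ {z} e → z ∈ₑ e → z ≡ tail e ⊎ z ≡ head e
  tail-or-head {z} e z∈e with z Finₚ.≟ tail e
  ... | yes z≡tail = inj₁ z≡tail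
  ... | no  z≢tail = inj₂ (sym (other-end e (tail∈ e) (head∈ e) z∈e (tail≢head e) (z≢tail ∘ sym)))

  Arc : Fin v → Fin v → Set
  Arc x y = Σ E λ e → tail e ≡ x × head e ≡ y

  arc-σ : ∀ h {x y} → Arc x y → Arc (σ h x) (σ h y)
  arc-σ h (e , refl , refl) = ρ h e , tail-ρ h e , head-ρ h e

  arc-adj : ∀ {x y} → Arc x y → adj x y ≡ true
  arc-adj (e , refl , refl) = ends-adjacent e (tail∈ e) (head∈ e) (tail≢head e)

  arc-or : ∀ {x y} → adj x y ≡ true → Arc x y ⊎ Arc y x
  arc-or xy with edge-through xy
  ... | e , x∈e , y∈e with tail-or-head e x∈e | tail-or-head e y∈e
  ...   | inj₁ x≡t | inj₂ y≡h = inj₁ (e , sym x≡t , sym y≡h)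
  ...   | inj₂ x≡h | inj₁ y≡t = inj₂ (e , sym y≡t , sym x≡h)
  ...   | inj₁ x≡t | inj₁ y≡t = ⊥-elim (adj⇒≢ xy (trans x≡t (sym y≡t)))
  ...   | inj₂ x≡h | inj₂ y≡h = ⊥-elim (adj⇒≢ xy (trans x≡h (sym y≡h)))

  arc-antisym : ∀ {x y} → Arc x y → Arc y x → ⊥
  arc-antisym (e , refl , refl) (e' , tail'≡ , head'≡) = tail≢head e (trans (cong tail e≡e') tail'≡)
    where
    e≡e' : e ≡ e'
    e≡e' = edge-unique e e' (tail≢head e) (tail∈ e) (head∈ e)
             (subst (_∈ₑ e') head'≡ (head∈ e')) (subst (_∈ₑ e') tail'≡ (tail∈ e'))

  no-arc : ∀ {x y} → adj x y ≡ false → ¬ Arc x y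
  no-arc x≁y x→y with () ← trans (sym (arc-adj x→y)) x≁y

  arc? : ∀ x y → Dec (Arc x y)
  arc? x y with adj x y in xy
  ... | false = no (no-arc xy)
  ... | true with arc-or xy
  ...   | inj₁ x→y = yes x→y
  ...   | inj₂ y→x = no (λ x→y → arc-antisym x→y y→x)

  orient : Fin v → Fin v → Bool
  orient x y = does (arc? x y)

  outdeg indeg : Fin v → ℕ
  outdeg x = count v (orient x)
  indeg  y = count v (λ x → orient x y)

  adj-splits : ∀ x y → 𝟙 (adj x y) ≡ 𝟙 (orient x y) + 𝟙 (orient y x)
  adj-splits x y = by-adjacency (adj x y) refl
    where
    counted : ∀ {b b'} → orient x y ≡ b → orient y x ≡ b' →
              𝟙 (orient x y) + 𝟙 (orient y x) ≡ 𝟙 b + 𝟙 b'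
    counted = cong₂ (λ b b' → 𝟙 b + 𝟙 b')
    by-adjacency : ∀ b → adj x y ≡ b → 𝟙 b ≡ 𝟙 (orient x y) + 𝟙 (orient y x)
    by-adjacency true xy with arc-or xy
    ... | inj₁ x→y = sym (counted (dec-true (arc? x y) x→y) (dec-false (arc? y x) (arc-antisym x→y)))
    ... | inj₂ y→x = sym (counted (dec-false (arc? x y) (λ x→y → arc-antisym x→y y→x)) (dec-true (arc? y x) y→x))
    by-adjacency false xy =
      sym (counted (dec-false (arc? x y) (no-arc xy)) (dec-false (arc? y x) (no-arc (trans (adj-sym y x) xy))))

  degree-splits : ∀ x → outdeg x + indeg x ≡ degree Γ x
  degree-splits x = sym (count-split v (adj x) (orient x) (λ y → orient y x) (adj-splits x))

  orient-σ : ∀ h x y → orient (σ h x) (σ h y) ≡ orient x y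
  orient-σ h x y = does-⇔ (mk⇔ untranslate (arc-σ h)) (arc? (σ h x) (σ h y)) (arc? x y)
    where
    untranslate : Arc (σ h x) (σ h y) → Arc x y
    untranslate a = subst₂ Arc (σ-inverseˡ h x) (σ-inverseˡ h y) (arc-σ (inv h) a)

  outdeg-σ : ∀ h x → outdeg (σ h x) ≡ outdeg x
  outdeg-σ h x = trans (sym (count-permute v (orient (σ h x)) (σ h) (σ (inv h)) (σ-inverseʳ h) (σ-inverseˡ h)))
                       (count-cong v (orient-σ h x))

  indeg-σ : ∀ h x → indeg (σ h x) ≡ indeg x
  indeg-σ h x = trans (sym (count-permute v (λ y → orient y (σ h x)) (σ h) (σ (inv h)) (σ-inverseʳ h) (σ-inverseˡ h)))
                      (count-cong v (λ y → orient-σ h y x))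

  Mixed : Fin v → Set
  Mixed x = (∃[ y ] Arc x y) × (∃[ w ] Arc w x)

  -- A mixed vertex can be moved to any vertex z: z is the tail or the head of
  -- some edge, and G carries an arc out of (resp. into) x onto that edge.
  mixed⇒transitive : ∀ {x} → Mixed x → ∀ z → ∃[ h ] σ h x ≡ z
  mixed⇒transitive {x} ((_ , e , tail≡x , _) , (_ , f , _ , head≡x)) z =
    reach (tail-or-head e' x∈e₁)
    where
    open TwoEdgesAt (star z) renaming (e₁ to e')
    reach : z ≡ tail e' ⊎ z ≡ head e' → ∃[ h ] σ h x ≡ z
    reach (inj₁ z≡tail) = inv (to e) ∙ to e' , (begin
      σ (inv (to e) ∙ to e') x          ≡⟨ cong (σ _) tail≡x ⟨
      σ (inv (to e) ∙ to e') (tail e)   ≡⟨ tail-ρ _ e ⟨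
      tail (ρ (inv (to e) ∙ to e') e)   ≡⟨ cong tail (ρ-carries e e') ⟩
      tail e'                           ≡⟨ z≡tail ⟨
      z                                 ∎)
      where open ≡-Reasoning
    reach (inj₂ z≡head) = inv (to f) ∙ to e' , (begin
      σ (inv (to f) ∙ to e') x          ≡⟨ cong (σ _) head≡x ⟨
      σ (inv (to f) ∙ to e') (head f)   ≡⟨ head-ρ _ f ⟨
      head (ρ (inv (to f) ∙ to e') f)   ≡⟨ cong head (ρ-carries f e') ⟩
      head e'                           ≡⟨ z≡head ⟨
      z                                 ∎)
      where open ≡-Reasoning

  -- With a mixed vertex all out-degrees agree and all in-degrees agree, so by
  -- double counting the valency at x is twice its out-degree.
  mixed⇒even-degree : ∀ {x} → Mixed x → degree Γ x ≡ outdeg x + outdeg x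
  mixed⇒even-degree {x} mixed = begin
    degree Γ x          ≡⟨ degree-splits x ⟨
    outdeg x + indeg x  ≡⟨ cong (outdeg x +_) out≡in ⟨
    outdeg x + outdeg x ∎
    where
    open ≡-Reasoning
    constant : (f : Fin v → ℕ) → (∀ h y → f (σ h y) ≡ f y) → ∀ z → f z ≡ f x
    constant f invariant z with mixed⇒transitive mixed z
    ... | h , σhx≡z = trans (cong f (sym σhx≡z)) (invariant h x)
    out≡in : outdeg x ≡ indeg x
    out≡in = balanced v {{Finₚ.nonZeroIndex x}} orient (constant outdeg outdeg-σ) (constant indeg indeg-σ)

  IsTail : Fin v → Set
  IsTail x = ∃[ y ] Arc x y

  tail⇒¬tail : (∀ x → ¬ Mixed x) → ∀ {x y} → adj x y ≡ true → IsTail x → ¬ IsTail y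
  tail⇒¬tail unmixed xy (y' , x→y') (y'' , y→y'') with arc-or xy
  ... | inj₁ x→y = unmixed _ ((y'' , y→y'') , (_ , x→y))
  ... | inj₂ y→x = unmixed _ ((y' , x→y') , (_ , y→x))

  ¬tail⇒tail : ∀ {x y} → adj x y ≡ true → ¬ IsTail x → IsTail y
  ¬tail⇒tail xy ¬tail with arc-or xy
  ... | inj₁ x→y = ⊥-elim (¬tail (_ , x→y))
  ... | inj₂ y→x = _ , y→x

-- No vertex is mixed, so being a tail 2-colours Γ; this contradicts the pentagon
-- through an endpoint of e₀ (which exists because the group is nonempty).
srg01-odd⇒line-graph-not-Cayley : ∀ {v} (Γ : SimpleGraph v) k m → k ≡ suc (2 * m) → 2 ≤ k →
                                  IsSRG Γ k 0 1 → ¬ IsCayley (Edge Γ) (LineAdj Γ)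
srg01-odd⇒line-graph-not-Cayley Γ k m k-odd 2≤k srg (n , _∙_ , ε , inv , isGroup , S , _ , _ , φ , cayley) =
  two-colouring⇒no-pentagon Γ IsTail (tail⇒¬tail no-mixed) ¬tail⇒tail (pentagon (Edges.lo Γ e₀))
  where
  open SRG01 Γ srg 2≤k
  open CayleyLineGraph Γ no△ star isGroup {S = S} φ cayley
  no-mixed : ∀ x → ¬ Mixed x
  no-mixed x mixed = ℕₚ.even≢odd (outdeg x) m (begin
    2 * outdeg x         ≡⟨ cong (outdeg x +_) (ℕₚ.+-identityʳ (outdeg x)) ⟩
    outdeg x + outdeg x  ≡⟨ mixed⇒even-degree mixed ⟨
    degree Γ x           ≡⟨ proj₁ srg x ⟩
    k                    ≡⟨ k-odd ⟩
    suc (2 * m)          ∎)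
    where open ≡-Reasoning

proposition5p3 : (Γ : SimpleGraph 3250) → IsSRG Γ 57 0 1 → ¬ IsCayley (Edge Γ) (LineAdj Γ)
proposition5p3 Γ = srg01-odd⇒line-graph-not-Cayley Γ 57 28 refl (s≤s (s≤s z≤n))
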